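{- The assignment $\mathscr B$ sending an $\mathbf{MK}$-frame $(X,R,E)$ to $((X,R),\pi_X,(X/E,R_0))$, where $\pi_X$ is the quotient map and $[x]\mathrel{R_0}[y]$ iff there is $z$ with $x\mathrel Rz$ and $z\mathrel Ey$, and sending a morphism $f:(X,R,E)\to(X',R',E')$ to $(f,f_0)$ with $f_0([x])=[f(x)]$, is a well-defined functor from the category $\mathsf{MKF}$ of $\mathbf{MK}$-frames to the category $\mathsf{KBn}$ of Kripke bundles.
   Context: A Kripke frame is $(X,R)$ with $X\neq\varnothing$, $R\subseteq X^2$; a p-morphism $f$ satisfies $f(R[x])=R'[f(x)]$. An $\mathbf{MK}$-frame is $(X,R,E)$ with $E$ an equivalence relation and: $x\mathrel Ey$, $y\mathrel Rz$ imply $x\mathrel Ru$, $u\mathrel Ez$ for some $u$; morphisms are maps that are p-morphisms for both $R$ and $E$. A Kripke bundle is $(\mathfrak F,\pi,\mathfrak F_0)$ with $\pi:\mathfrak F\to\mathfrak F_0$ a surjective p-morphism of Kripke frames; a morphism $(f,g)$ of bundles consists of p-morphisms with $g\circ\pi=\pi'\circ f$ such that $f$ maps each fibre $\pi^{ -1}(w)$ onto $\pi'^{ -1}(g(w))$. -}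

module Defs where

open import Level using (Level; _⊔_) renaming (suc to lsuc)
open import Function using (id; _∘_)
open import Data.Product using (Σ; ∃; ∃-syntax; _×_; _,_)
open import Relation.Binary using (Rel; IsEquivalence)
open import Relation.Binary.PropositionalEquality using (_≡_)

-- A (raw) Kripke frame whose carrier is a set presented as a setoid
-- (Agda has no quotient types, so quotient sets X/E are modelled as the
-- carrier X with equality E).  'point' witnesses X ≠ ∅.
record Frame (c ℓ r : Level) : Set (lsuc (c ⊔ ℓ ⊔ r)) where
  field
    Carrier : Set c
    _≈_     : Rel Carrier ℓ
    R       : Rel Carrier r
    point   : Carrier

IsKripkeFrame : ∀ {c ℓ r} → Frame c ℓ r → Set (c ⊔ ℓ ⊔ r)
IsKripkeFrame F = IsEquivalence _≈_
  × (∀ {x x' y y'} → x ≈ x' → y ≈ y' → R x y → R x' y')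
  where open Frame F

IsPMorphism : ∀ {c ℓ r c' ℓ' r'} (F : Frame c ℓ r) (G : Frame c' ℓ' r') →
  (Frame.Carrier F → Frame.Carrier G) → Set (c ⊔ ℓ ⊔ r ⊔ c' ⊔ ℓ' ⊔ r')
IsPMorphism F G f =
    (∀ {x y} → F._≈_ x y → G._≈_ (f x) (f y))
  × (∀ {x y} → F.R x y → G.R (f x) (f y))
  × (∀ {x y'} → G.R (f x) y' → ∃[ y ] (F.R x y × G._≈_ (f y) y'))
  where module F = Frame F ; module G = Frame G

IsSurjective : ∀ {c ℓ r c' ℓ' r'} (F : Frame c ℓ r) (G : Frame c' ℓ' r') →
  (Frame.Carrier F → Frame.Carrier G) → Set (c ⊔ c' ⊔ ℓ')
IsSurjective F G f = ∀ y → ∃[ x ] (Frame._≈_ G (f x) y)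

record Bundle (c ℓ r c₀ ℓ₀ r₀ : Level) : Set (lsuc (c ⊔ ℓ ⊔ r ⊔ c₀ ⊔ ℓ₀ ⊔ r₀)) where
  field
    total : Frame c ℓ r
    base  : Frame c₀ ℓ₀ r₀
    proj  : Frame.Carrier total → Frame.Carrier base

IsKripkeBundle : ∀ {c ℓ r c₀ ℓ₀ r₀} → Bundle c ℓ r c₀ ℓ₀ r₀ → Set (c ⊔ ℓ ⊔ r ⊔ c₀ ⊔ ℓ₀ ⊔ r₀)
IsKripkeBundle B = IsKripkeFrame total × IsKripkeFrame base
  × IsPMorphism total base proj × IsSurjective total base proj
  where open Bundle B

IsBundleMorphism : ∀ {c ℓ r c₀ ℓ₀ r₀} (B B' : Bundle c ℓ r c₀ ℓ₀ r₀) →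
  (Frame.Carrier (Bundle.total B) → Frame.Carrier (Bundle.total B')) →
  (Frame.Carrier (Bundle.base B) → Frame.Carrier (Bundle.base B')) → Set (c ⊔ ℓ ⊔ r ⊔ c₀ ⊔ ℓ₀ ⊔ r₀)
IsBundleMorphism B B' f g =
    IsPMorphism B.total B'.total f
  × IsPMorphism B.base B'.base g
  × (∀ x → Frame._≈_ B'.base (g (B.proj x)) (B'.proj (f x)))
  × (∀ w x → Frame._≈_ B.base (B.proj x) w →
       Frame._≈_ B'.base (B'.proj (f x)) (g w))
  × (∀ w x' → Frame._≈_ B'.base (B'.proj x') (g w) →
       ∃[ x ] (Frame._≈_ B.base (B.proj x) w × Frame._≈_ B'.total (f x) x'))
  where module B = Bundle B ; module B' = Bundle B'

SameBundleMap : ∀ {c ℓ r c₀ ℓ₀ r₀} (B B' : Bundle c ℓ r c₀ ℓ₀ r₀) →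
  (Frame.Carrier (Bundle.total B) → Frame.Carrier (Bundle.total B')) ×
  (Frame.Carrier (Bundle.base B) → Frame.Carrier (Bundle.base B')) →
  (Frame.Carrier (Bundle.total B) → Frame.Carrier (Bundle.total B')) ×
  (Frame.Carrier (Bundle.base B) → Frame.Carrier (Bundle.base B')) → Set (c ⊔ ℓ ⊔ c₀ ⊔ ℓ₀)
SameBundleMap B B' (f , g) (f' , g') =
  (∀ x → Frame._≈_ (Bundle.total B') (f x) (f' x)) ×
  (∀ w → Frame._≈_ (Bundle.base B') (g w) (g' w))

idBundleMap : ∀ {c ℓ r c₀ ℓ₀ r₀} (B : Bundle c ℓ r c₀ ℓ₀ r₀) →
  (Frame.Carrier (Bundle.total B) → Frame.Carrier (Bundle.total B)) ×
  (Frame.Carrier (Bundle.base B) → Frame.Carrier (Bundle.base B))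
idBundleMap B = (id , id)

record MKFrame (c ℓ r : Level) : Set (lsuc (c ⊔ ℓ ⊔ r)) where
  field
    Carrier : Set c
    R       : Rel Carrier r
    E       : Rel Carrier ℓ
    isEquivalenceE : IsEquivalence E
    point   : Carrier
    mk      : ∀ {x y z} → E x y → R y z → ∃[ u ] (R x u × E u z)

RFrame : ∀ {c ℓ r} → MKFrame c ℓ r → Frame c c r
RFrame M = record { Carrier = Carrier ; _≈_ = _≡_ ; R = R ; point = point }
  where open MKFrame M

EFrame : ∀ {c ℓ r} → MKFrame c ℓ r → Frame c c ℓ
EFrame M = record { Carrier = Carrier ; _≈_ = _≡_ ; R = E ; point = point }
  where open MKFrame M

IsMKMorphism : ∀ {c ℓ r} (M M' : MKFrame c ℓ r) →
  (MKFrame.Carrier M → MKFrame.Carrier M') → Set (c ⊔ ℓ ⊔ r)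
IsMKMorphism M M' f = IsPMorphism (RFrame M) (RFrame M') f × IsPMorphism (EFrame M) (EFrame M') f

QuotFrame : ∀ {c ℓ r} → MKFrame c ℓ r → Frame c ℓ (c ⊔ ℓ ⊔ r)
QuotFrame M = record { Carrier = Carrier ; _≈_ = E ; R = λ x y → ∃[ z ] (R x z × E z y) ; point = point }
  where open MKFrame M

-- 𝓑 on objects: ((X,R), π_X, (X/E, R₀)), π_X x = [x] (represented by x)
𝓑₀ : ∀ {c ℓ r} → MKFrame c ℓ r → Bundle c c r c ℓ (c ⊔ ℓ ⊔ r)
𝓑₀ M = record { total = RFrame M ; base = QuotFrame M ; proj = id }

-- 𝓑 on morphisms: f ↦ (f , f₀), f₀ [x] = [f x] (on representatives: f₀ = f)
𝓑₁ : ∀ {c ℓ r} {M M' : MKFrame c ℓ r} → (MKFrame.Carrier M → MKFrame.Carrier M') →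
  (MKFrame.Carrier M → MKFrame.Carrier M') × (MKFrame.Carrier M → MKFrame.Carrier M')
𝓑₁ f = (f , f)

compBundleMap : ∀ {a b c a₀ b₀ c₀} {A : Set a} {B : Set b} {C : Set c}
  {A₀ : Set a₀} {B₀ : Set b₀} {C₀ : Set c₀} →
  (B → C) × (B₀ → C₀) → (A → B) × (A₀ → B₀) → (A → C) × (A₀ → C₀)
compBundleMap (f' , g') (f , g) = (f' ∘ f , g' ∘ g)

-- The MK condition E ; R ⊆ R ; E is what makes R₀ = R ; E respect
-- E-classes on both sides, so (X/E, R₀) is a Kripke frame and the quotient
-- map is a p-morphism (its back condition is witnessed by z itself).  For a
-- morphism f, the R-conditions of f give those of f₀, and the E-back
-- condition says exactly that f maps each E-class onto an E'-class.
-- Since f₀ acts on representatives as f, functoriality is pointwise reflexivity.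
module Submission where

open import Defs
open import Level using (Level; _⊔_)
open import Function using (id; _∘_)
open import Data.Product using (_×_; _,_; proj₁; proj₂; ∃-syntax)
open import Relation.Binary using (IsEquivalence)
open import Relation.Binary.PropositionalEquality as ≡ using (_≡_; refl)

module _ {c ℓ r : Level} (M : MKFrame c ℓ r) where
  open MKFrame M
  private module E = IsEquivalence isEquivalenceE

  R₀ : Carrier → Carrier → Set (c ⊔ ℓ ⊔ r)
  R₀ = Frame.R (QuotFrame M)

  R₀-resp-E : ∀ {x x' y y'} → E x x' → E y y' → R₀ x y → R₀ x' y'
  R₀-resp-E x~x' y~y' (z , xRz , z~y) with mk (E.sym x~x') xRz
  ... | u , x'Ru , u~z = u , x'Ru , E.trans u~z (E.trans z~y y~y')

  RFrame-isKripkeFrame : IsKripkeFrame (RFrame M)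
  RFrame-isKripkeFrame = ≡.isEquivalence , λ { refl refl xRy → xRy }

  QuotFrame-isKripkeFrame : IsKripkeFrame (QuotFrame M)
  QuotFrame-isKripkeFrame = isEquivalenceE , R₀-resp-E

  quotient-isPMorphism : IsPMorphism (RFrame M) (QuotFrame M) id
  quotient-isPMorphism =
      (λ { refl → E.refl })
    , (λ {_} {y} xRy → y , xRy , E.refl)
    , id

  quotient-isSurjective : IsSurjective (RFrame M) (QuotFrame M) id
  quotient-isSurjective y = y , E.refl

  𝓑₀-isKripkeBundle : IsKripkeBundle (𝓑₀ M)
  𝓑₀-isKripkeBundle =
      RFrame-isKripkeFrame
    , QuotFrame-isKripkeFrame
    , quotient-isPMorphism
    , quotient-isSurjective

module _ {c ℓ r : Level} {M M' : MKFrame c ℓ r}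
         {f : MKFrame.Carrier M → MKFrame.Carrier M'}
         (f-isMKMorphism : IsMKMorphism M M' f) where
  private
    module M = MKFrame M
    module M' = MKFrame M'
    module E = IsEquivalence M.isEquivalenceE
    module E' = IsEquivalence M'.isEquivalenceE

    R-forth : ∀ {x y} → M.R x y → M'.R (f x) (f y)
    R-forth = proj₁ (proj₂ (proj₁ f-isMKMorphism))

    R-back : ∀ {x y'} → M'.R (f x) y' → ∃[ y ] (M.R x y × f y ≡ y')
    R-back = proj₂ (proj₂ (proj₁ f-isMKMorphism))

    E-forth : ∀ {x y} → M.E x y → M'.E (f x) (f y)
    E-forth = proj₁ (proj₂ (proj₂ f-isMKMorphism))

    E-back : ∀ {x y'} → M'.E (f x) y' → ∃[ y ] (M.E x y × f y ≡ y')
    E-back = proj₂ (proj₂ (proj₂ f-isMKMorphism))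

  quotientMap-isPMorphism : IsPMorphism (QuotFrame M) (QuotFrame M') f
  quotientMap-isPMorphism = E-forth , R₀-forth , R₀-back
    where
    R₀-forth : ∀ {x y} → R₀ M x y → R₀ M' (f x) (f y)
    R₀-forth (z , xRz , z~y) = f z , R-forth xRz , E-forth z~y

    R₀-back : ∀ {x y'} → R₀ M' (f x) y' → ∃[ y ] (R₀ M x y × M'.E (f y) y')
    R₀-back (z' , fxRz' , z'~y') with R-back fxRz'
    ... | y , xRy , refl = y , (y , xRy , E.refl) , z'~y'

  map-fibre-onto : ∀ w x' → M'.E x' (f w) → ∃[ x ] (M.E x w × f x ≡ x')
  map-fibre-onto w x' x'~fw with E-back (E'.sym x'~fw)
  ... | x , w~x , fx≡x' = x , E.sym w~x , fx≡x'

  𝓑₁-isBundleMorphism : IsBundleMorphism (𝓑₀ M) (𝓑₀ M') f f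
  𝓑₁-isBundleMorphism =
      proj₁ f-isMKMorphism
    , quotientMap-isPMorphism
    , (λ _ → E'.refl)
    , (λ _ _ → E-forth)
    , map-fibre-onto

proposition4p3 : ∀ {c ℓ r : Level} →
    -- objects: 𝓑 M is a Kripke bundle
    (∀ (M : MKFrame c ℓ r) → IsKripkeBundle (𝓑₀ M))
    -- morphisms: 𝓑 f = (f , f₀) is a well-defined morphism of Kripke bundles
  × (∀ (M M' : MKFrame c ℓ r) (f : MKFrame.Carrier M → MKFrame.Carrier M') →
       IsMKMorphism M M' f →
       IsBundleMorphism (𝓑₀ M) (𝓑₀ M') f f)
    -- preservation of identities
  × (∀ (M : MKFrame c ℓ r) →
       SameBundleMap (𝓑₀ M) (𝓑₀ M) (𝓑₁ {M = M} {M' = M} id) (idBundleMap (𝓑₀ M)))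
    -- preservation of composition
  × (∀ (M M' M'' : MKFrame c ℓ r)
       (f : MKFrame.Carrier M → MKFrame.Carrier M')
       (g : MKFrame.Carrier M' → MKFrame.Carrier M'') →
       IsMKMorphism M M' f → IsMKMorphism M' M'' g →
       SameBundleMap (𝓑₀ M) (𝓑₀ M'') (𝓑₁ {M = M} {M' = M''} (g ∘ f))
         (compBundleMap (𝓑₁ {M = M'} {M' = M''} g) (𝓑₁ {M = M} {M' = M'} f)))
proposition4p3 =
    𝓑₀-isKripkeBundle
  , (λ M M' _ → 𝓑₁-isBundleMorphism {M = M} {M'})
  , (λ M → (λ _ → refl) , (λ _ → E-refl M))
  , (λ _ _ M'' _ _ _ _ → (λ _ → refl) , (λ _ → E-refl M''))
  where
  E-refl : ∀ {c ℓ r} (M : MKFrame c ℓ r) {x : MKFrame.Carrier M} → MKFrame.E M x x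
  E-refl M = IsEquivalence.refl (MKFrame.isEquivalenceE M)
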